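{- Let $q=2^r$ and let $\psi$ be a nontrivial additive character of $\mathbb{F}_q$. Then (a) $\sum_{i\in SO^-(2,q)}\psi(Tr\, i)=-K(\psi;1)$; (b) $\sum_{i\in O^-(2,q)}\psi(Tr\, i)=-K(\psi;1)+q+1$.
   Context: $\mathbb{F}_q$ is the field with $q=2^r$ elements; $Tr$ is the matrix trace. $K(\psi;a)=\sum_{\alpha\in\mathbb{F}_q^*}\psi(\alpha+a\alpha^{ -1})$ for $a\in\mathbb{F}_q^*$. Fix $c\in\mathbb{F}_q$ with $z^2+z+c$ irreducible over $\mathbb{F}_q$. $O^-(2,q)$ is the group of $2\times 2$ matrices over $\mathbb{F}_q$ preserving the quadratic form $\theta(x_1,x_2)=x_1^2+x_1x_2+cx_2^2$ on $\mathbb{F}_q^{2\times1}$, and $SO^-(2,q)=\left\{\begin{bmatrix}d_1&cd_2\\d_2&d_1+d_2\end{bmatrix}: d_1^2+d_1d_2+cd_2^2=1\right\}$, a subgroup of index $2$ in $O^-(2,q)$. -}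

module Defs where

open import Level using (Level; suc; _⊔_)
open import Data.Nat using (ℕ; _^_)
open import Data.Integer using (ℤ; +_) renaming (_+_ to _+ℤ_; _*_ to _*ℤ_)
open import Data.List using (List; map; filter; foldr; length; cartesianProduct)
open import Data.List.Membership.Propositional using (_∈_)
open import Data.List.Relation.Unary.Unique.Propositional using (Unique)
open import Data.List.Relation.Unary.All using (All; all?)
open import Data.Product using (Σ; _×_; _,_; proj₁; proj₂)
open import Relation.Nullary using (¬_; Dec; ¬?)
open import Relation.Nullary.Decidable using (_×-dec_)
open import Relation.Binary.PropositionalEquality using (_≡_; _≢_)
open import Relation.Binary.Definitions using (DecidableEquality)
open import Algebra.Structures using (IsCommutativeRing)

-- The inverse is total for convenience; only its values on nonzero elements
-- are constrained (and only those are ever used).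
record FiniteField (r : ℕ) : Set₁ where
  infixl 6 _+_
  infixl 7 _*_
  infix 4 _≟_
  field
    Carrier  : Set
    _+_ _*_  : Carrier → Carrier → Carrier
    -_       : Carrier → Carrier
    0# 1#    : Carrier
    _⁻¹      : Carrier → Carrier
    isCommutativeRing : IsCommutativeRing _≡_ _+_ _*_ -_ 0# 1#
    0≢1      : 0# ≢ 1#
    inverseʳ : ∀ x → x ≢ 0# → x * (x ⁻¹) ≡ 1#
    _≟_      : DecidableEquality Carrier
    elements : List Carrier
    unique   : Unique elements
    complete : ∀ x → x ∈ elements
    card     : length elements ≡ 2 ^ r

sumℤ : List ℤ → ℤ
sumℤ = foldr _+ℤ_ (+ 0)

module _ {r : ℕ} (F : FiniteField r) where
  open FiniteField F

  -- an additive character of F, taking values in ℤ ⊂ ℂ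
  -- (in characteristic 2 every additive character takes values in {±1})
  record AdditiveCharacter : Set where
    field
      ψ      : Carrier → ℤ
      ψ-0    : ψ 0# ≡ + 1
      ψ-hom  : ∀ x y → ψ (x + y) ≡ ψ x *ℤ ψ y

  Nontrivial : AdditiveCharacter → Set
  Nontrivial χ = Σ Carrier λ x → AdditiveCharacter.ψ χ x ≢ + 1

  -- z² + z + c irreducible over F: it is not a product of two polynomials
  -- of degree 1, (a z + b)(e z + f) = a e z² + (a f + b e) z + b f.
  IrreducibleZ²+Z+ : Carrier → Set
  IrreducibleZ²+Z+ c = ¬ (Σ Carrier λ a → Σ Carrier λ b → Σ Carrier λ e → Σ Carrier λ f →
      a ≢ 0# × e ≢ 0# × a * e ≡ 1# × a * f + b * e ≡ 1# × b * f ≡ c)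

  Mat₂ : Set
  Mat₂ = Carrier × Carrier × Carrier × Carrier

  Vec₂ : Set
  Vec₂ = Carrier × Carrier

  allVec₂ : List Vec₂
  allVec₂ = cartesianProduct elements elements

  allMat₂ : List Mat₂
  allMat₂ = cartesianProduct elements (cartesianProduct elements allVec₂)

  apply : Mat₂ → Vec₂ → Vec₂
  apply (m11 , m12 , m21 , m22) (x1 , x2) = (m11 * x1 + m12 * x2 , m21 * x1 + m22 * x2)

  tr : Mat₂ → Carrier
  tr (m11 , _ , _ , m22) = m11 + m22

  θ : Carrier → Vec₂ → Carrier
  θ c (x1 , x2) = x1 * x1 + x1 * x2 + c * (x2 * x2)

  InO⁻ : Carrier → Mat₂ → Set
  InO⁻ c M = All (λ x → θ c (apply M x) ≡ θ c x) allVec₂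

  InO⁻? : ∀ c M → Dec (InO⁻ c M)
  InO⁻? c M = all? (λ x → θ c (apply M x) ≟ θ c x) allVec₂

  InSO⁻ : Carrier → Mat₂ → Set
  InSO⁻ c (m11 , m12 , m21 , m22) =
    m12 ≡ c * m21 × m22 ≡ m11 + m21 × m11 * m11 + m11 * m21 + c * (m21 * m21) ≡ 1#

  InSO⁻? : ∀ c M → Dec (InSO⁻ c M)
  InSO⁻? c (m11 , m12 , m21 , m22) =
    (m12 ≟ c * m21) ×-dec ((m22 ≟ m11 + m21) ×-dec (m11 * m11 + m11 * m21 + c * (m21 * m21) ≟ 1#))

  O⁻ SO⁻ : Carrier → List Mat₂
  O⁻  c = filter (InO⁻? c) allMat₂
  SO⁻ c = filter (InSO⁻? c) allMat₂

  K : AdditiveCharacter → Carrier → ℤ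
  K χ a = sumℤ (map (λ α → AdditiveCharacter.ψ χ (α + a * (α ⁻¹)))
                    (filter (λ α → ¬? (α ≟ 0#)) elements))

  charSumTr : AdditiveCharacter → List Mat₂ → ℤ
  charSumTr χ S = sumℤ (map (λ M → AdditiveCharacter.ψ χ (tr M)) S)

{-# OPTIONS --safe #-}
module Submission where

-- In characteristic 2 the trace of [[d₁, c d₂], [d₂, d₁ + d₂]] ∈ SO⁻ is d₂, so the sum over SO⁻ is
-- Σ_β A(β) ψ(β) with A(β) = #{a : θ(a, β) = 1}, while K(ψ; 1) = Σ_β B(β) ψ(β) with
-- B(β) = #{α ≠ 0 : α + α⁻¹ = β}. Both are fibre sizes of the additive map z ↦ z² + βz, over 1 + cβ²
-- and over 1. For β ≠ 0 its fibres have at most two points, and d, d + cβ² are never both values since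
-- cβ² is not one (z² + z + c is irreducible); as the fibre sizes add up to q, A(β) + B(β) = 2, which
-- also holds for β = 0. Hence the sum over SO⁻ plus K(ψ; 1) is 2 Σ ψ = 0. The other coset of SO⁻ in O⁻
-- consists of the matrices [[a, ce + a], [e, a]] with θ(a, e) = 1: they have trace 0, and there are
-- Σ_β A(β) = 2q − (q − 1) = q + 1 of them.

open import Defs
open import Level using (0ℓ)
open import Data.Bool using (Bool; true; false; _xor_; _∧_)
open import Data.Integer as ℤ using (ℤ; 0ℤ; 1ℤ)
import Data.Integer.Properties as ℤP
open import Data.Integer.Solver using (module +-*-Solver)
open import Data.List using (List; []; _∷_; map; filter; foldr; length; _++_; cartesianProduct)
open import Data.List.Membership.Propositional using (_∈_; _∉_; lose)
open import Data.List.Membership.Propositional.Properties using (∈-cartesianProduct⁺)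
open import Data.List.Relation.Unary.All as All using (All)
open import Data.List.Relation.Unary.Any using (here; there; any?; satisfied)
open import Data.List.Relation.Unary.AllPairs using (_∷_)
open import Data.List.Relation.Unary.Unique.Propositional using (Unique)
open import Data.Maybe using (Maybe; just; nothing)
open import Data.Nat as ℕ using (ℕ; zero; suc; _^_)
open import Data.Product using (∃; _×_; _,_)
open import Data.Sum using (_⊎_; inj₁; inj₂; [_,_]′)
open import Algebra.Bundles using (RawMonoid; RawRing; CommutativeSemigroup; CommutativeRing)
open import Algebra.Structures using (IsCommutativeMonoid; IsCommutativeRing)
import Algebra.Definitions.RawMonoid as RawMonoidDefinitions
import Algebra.Properties.CommutativeSemigroup as CommutativeSemigroupProperties
import Algebra.Properties.Semiring.Mult as SemiringMult
import Algebra.Solver.Ring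
import Algebra.Solver.Ring.AlmostCommutativeRing as ACR
open import Function using (_∘′_)
open import Relation.Nullary using (¬_; Dec; yes; no; ¬?; contradiction)
import Relation.Nullary.Decidable as Dec
open import Relation.Nullary.Decidable using (_×-dec_)
open import Relation.Unary using (Decidable)
open import Relation.Binary.Definitions using (DecidableEquality)
open import Relation.Binary.PropositionalEquality

module BigOperators {A : Set} {_∙_ : A → A → A} {ε : A}
                    (isCommutativeMonoid : IsCommutativeMonoid _≡_ _∙_ ε) where

  open IsCommutativeMonoid isCommutativeMonoid
    using (assoc; identityˡ; identityʳ; isCommutativeSemigroup)
  commutativeSemigroup : CommutativeSemigroup 0ℓ 0ℓ
  commutativeSemigroup = record { isCommutativeSemigroup = isCommutativeSemigroup }

  rawMonoid : RawMonoid 0ℓ 0ℓ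
  rawMonoid = record { Carrier = A ; _≈_ = _≡_ ; _∙_ = _∙_ ; ε = ε }

  open CommutativeSemigroupProperties commutativeSemigroup using (interchange)
  open RawMonoidDefinitions rawMonoid using () renaming (_×_ to _×′_)

  ∑ : {X : Set} → List X → (X → A) → A
  ∑ xs f = foldr _∙_ ε (map f xs)

  ∑-cong : {X : Set} (xs : List X) {f g : X → A} → (∀ x → f x ≡ g x) → ∑ xs f ≡ ∑ xs g
  ∑-cong []       f≡g = refl
  ∑-cong (x ∷ xs) f≡g = cong₂ _∙_ (f≡g x) (∑-cong xs f≡g)

  ∑-const : {X : Set} (xs : List X) (v : A) → ∑ xs (λ _ → v) ≡ length xs ×′ v
  ∑-const []       v = refl
  ∑-const (x ∷ xs) v = cong (v ∙_) (∑-const xs v)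

  ∑-ε : {X : Set} (xs : List X) → ∑ xs (λ _ → ε) ≡ ε
  ∑-ε []       = refl
  ∑-ε (x ∷ xs) = trans (identityˡ _) (∑-ε xs)

  ∑-∙ : {X : Set} (xs : List X) (f g : X → A) → ∑ xs (λ x → f x ∙ g x) ≡ ∑ xs f ∙ ∑ xs g
  ∑-∙ []       f g = sym (identityˡ ε)
  ∑-∙ (x ∷ xs) f g = trans (cong ((f x ∙ g x) ∙_) (∑-∙ xs f g)) (interchange _ _ _ _)

  ∑-++ : {X : Set} (xs ys : List X) (g : X → A) → ∑ (xs ++ ys) g ≡ ∑ xs g ∙ ∑ ys g
  ∑-++ []       ys g = sym (identityˡ _)
  ∑-++ (x ∷ xs) ys g = trans (cong (g x ∙_) (∑-++ xs ys g)) (sym (assoc _ _ _))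

  ∑-map : {X Y : Set} (xs : List X) (h : X → Y) (g : Y → A) → ∑ (map h xs) g ≡ ∑ xs (λ x → g (h x))
  ∑-map []       h g = refl
  ∑-map (x ∷ xs) h g = cong (g (h x) ∙_) (∑-map xs h g)

  ∑-cartesianProduct : {X Y : Set} (xs : List X) (ys : List Y) (g : X × Y → A) →
    ∑ (cartesianProduct xs ys) g ≡ ∑ xs (λ x → ∑ ys (λ y → g (x , y)))
  ∑-cartesianProduct []       ys g = refl
  ∑-cartesianProduct (x ∷ xs) ys g =
    trans (∑-++ (map (x ,_) ys) _ g) (cong₂ _∙_ (∑-map ys (x ,_) g) (∑-cartesianProduct xs ys g))

  ∑-comm : {X Y : Set} (xs : List X) (ys : List Y) (g : X → Y → A) →
    ∑ xs (λ x → ∑ ys (g x)) ≡ ∑ ys (λ y → ∑ xs (λ x → g x y))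
  ∑-comm []       ys g = sym (∑-ε ys)
  ∑-comm (x ∷ xs) ys g =
    trans (cong (∑ ys (g x) ∙_) (∑-comm xs ys g)) (sym (∑-∙ ys (g x) (λ y → ∑ xs (λ x′ → g x′ y))))

  when : {P : Set} → Dec P → A → A
  when (yes _) v = v
  when (no _)  _ = ε

  when-cong : {P Q : Set} (p : Dec P) (q : Dec Q) → (P → Q) → (Q → P) → ∀ v → when p v ≡ when q v
  when-cong (yes _)  (yes _)  _   _   v = refl
  when-cong (yes p)  (no ¬q)  p⇒q _   v = contradiction (p⇒q p) ¬q
  when-cong (no ¬p)  (yes q)  _   q⇒p v = contradiction (q⇒p q) ¬p
  when-cong (no _)   (no _)   _   _   v = refl

  when-no : {P : Set} (p : Dec P) → ¬ P → ∀ v → when p v ≡ ε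
  when-no (yes p) ¬p v = contradiction p ¬p
  when-no (no _)  _  v = refl

  when-× : {P Q : Set} (p : Dec P) (q : Dec Q) → ∀ v → when (p ×-dec q) v ≡ when p (when q v)
  when-× (yes _) (yes _) v = refl
  when-× (yes _) (no _)  v = refl
  when-× (no _)  (yes _) v = refl
  when-× (no _)  (no _)  v = refl

  when-⊎ : {P Q R : Set} (p : Dec P) (q : Dec Q) (r : Dec R) →
    (P → Q ⊎ R) → (Q → P) → (R → P) → (Q → ¬ R) → ∀ v → when p v ≡ when q v ∙ when r v
  when-⊎ (yes _)  (yes q)  (yes r)  _   _   _   q⇒¬r v = contradiction r (q⇒¬r q)
  when-⊎ (yes _)  (yes _)  (no _)   _   _   _   _    v = sym (identityʳ v)
  when-⊎ (yes _)  (no _)   (yes _)  _   _   _   _    v = sym (identityˡ v)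
  when-⊎ (yes p)  (no ¬q)  (no ¬r)  p⇒  _   _   _    v with p⇒ p
  ... | inj₁ q = contradiction q ¬q
  ... | inj₂ r = contradiction r ¬r
  when-⊎ (no ¬p)  (yes q)  _        _   q⇒p _   _    v = contradiction (q⇒p q) ¬p
  when-⊎ (no ¬p)  (no _)   (yes r)  _   _   r⇒p _    v = contradiction (r⇒p r) ¬p
  when-⊎ (no _)   (no _)   (no _)   _   _   _   _    v = sym (identityˡ ε)

  ∑-when : {X P : Set} (xs : List X) (p : Dec P) (g : X → A) → ∑ xs (λ x → when p (g x)) ≡ when p (∑ xs g)
  ∑-when xs (yes _) g = refl
  ∑-when xs (no _)  g = ∑-ε xs

  ∑-filter : {X : Set} {P : X → Set} (P? : Decidable P) (xs : List X) (g : X → A) →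
    ∑ (filter P? xs) g ≡ ∑ xs (λ x → when (P? x) (g x))
  ∑-filter P? []       g = refl
  ∑-filter P? (x ∷ xs) g with P? x
  ... | yes _ = cong (g x ∙_) (∑-filter P? xs g)
  ... | no _  = trans (∑-filter P? xs g) (sym (identityˡ _))

  when-¬?∙when : {P : Set} (p : Dec P) (v : A) → when (¬? p) v ∙ when p v ≡ v
  when-¬?∙when (yes _) v = identityˡ v
  when-¬?∙when (no _)  v = identityʳ v

  module _ {X : Set} (_≟_ : DecidableEquality X) where

    ∑-when-≡-∉ : (z : X) (xs : List X) (g : X → A) → z ∉ xs → ∑ xs (λ y → when (y ≟ z) (g y)) ≡ ε
    ∑-when-≡-∉ z []       g z∉ = refl
    ∑-when-≡-∉ z (x ∷ xs) g z∉ with x ≟ z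
    ... | yes refl = contradiction (here refl) z∉
    ... | no _     = trans (identityˡ _) (∑-when-≡-∉ z xs g (z∉ ∘′ there))

    ∑-when-≡ : (z : X) (xs : List X) (g : X → A) → Unique xs → z ∈ xs → ∑ xs (λ y → when (y ≟ z) (g y)) ≡ g z
    ∑-when-≡ z (x ∷ xs) g (x∉ ∷ _) (here refl) with x ≟ x
    ... | yes _  = trans (cong (g x ∙_) (∑-when-≡-∉ x xs g (λ x∈ → All.lookup x∉ x∈ refl))) (identityʳ _)
    ... | no x≢x = contradiction refl x≢x
    ∑-when-≡ z (x ∷ xs) g (x∉ ∷ u) (there z∈) with x ≟ z
    ... | yes refl = contradiction refl (All.lookup x∉ z∈)
    ... | no _     = trans (identityˡ _) (∑-when-≡ z xs g u z∈)

  module Enumeration {X : Set} (_≟_ : DecidableEquality X)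
                     (xs : List X) (unique : Unique xs) (complete : ∀ x → x ∈ xs) where

    ∑-δ : (z : X) (g : X → A) → ∑ xs (λ y → when (y ≟ z) (g y)) ≡ g z
    ∑-δ z g = ∑-when-≡ _≟_ z xs g unique (complete z)

    ∑-δ′ : (z : X) (g : X → A) → ∑ xs (λ y → when (z ≟ y) (g y)) ≡ g z
    ∑-δ′ z g = trans (∑-cong xs (λ y → when-cong (z ≟ y) (y ≟ z) sym sym (g y))) (∑-δ z g)

    ∑-reindex : (σ τ : X → X) → (∀ y → σ (τ y) ≡ y) → (∀ x → τ (σ x) ≡ x) → (g : X → A) →
      ∑ xs (λ x → g (σ x)) ≡ ∑ xs g
    ∑-reindex σ τ στ τσ g = begin
      ∑ xs (λ x → g (σ x))                                 ≡⟨ ∑-cong xs (λ x → sym (∑-δ (σ x) g)) ⟩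
      ∑ xs (λ x → ∑ xs (λ y → when (y ≟ σ x) (g y)))       ≡⟨ ∑-comm xs xs _ ⟩
      ∑ xs (λ y → ∑ xs (λ x → when (y ≟ σ x) (g y)))       ≡⟨ ∑-cong xs (λ y → ∑-cong xs (λ x →
                                                                 when-cong (y ≟ σ x) (x ≟ τ y) (y≡σx⇒x≡τy y x) (x≡τy⇒y≡σx y x) (g y))) ⟩
      ∑ xs (λ y → ∑ xs (λ x → when (x ≟ τ y) (g y)))       ≡⟨ ∑-cong xs (λ y → ∑-δ (τ y) (λ _ → g y)) ⟩
      ∑ xs g                                               ∎
      where
      open ≡-Reasoning
      y≡σx⇒x≡τy : ∀ y x → y ≡ σ x → x ≡ τ y
      y≡σx⇒x≡τy y x refl = sym (τσ x)
      x≡τy⇒y≡σx : ∀ y x → x ≡ τ y → y ≡ σ x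
      x≡τy⇒y≡σx y x refl = sym (στ y)

module FieldProperties {r : ℕ} (F : FiniteField r) where

  open FiniteField F
  open IsCommutativeRing isCommutativeRing
    using (+-assoc; +-identityˡ; +-identityʳ; *-assoc; *-comm; *-identityˡ; zeroˡ; zeroʳ; distribʳ; *-identityʳ; -‿inverseˡ; -‿inverseʳ;
           +-isCommutativeMonoid)

  commutativeRing : CommutativeRing 0ℓ 0ℓ
  commutativeRing = record { isCommutativeRing = isCommutativeRing }

  open CommutativeRing commutativeRing using (semiring; +-group)
  open SemiringMult semiring using (×1-homo-*) renaming (_×_ to _×′_)
  open import Algebra.Properties.Group +-group using (identityʳ-unique; inverseˡ-unique; ε⁻¹≈ε)
  open BigOperators +-isCommutativeMonoid
  open Enumeration _≟_ elements unique complete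

  x⁻¹*x≡1 : ∀ {x} → x ≢ 0# → x ⁻¹ * x ≡ 1#
  x⁻¹*x≡1 {x} x≢0 = trans (*-comm (x ⁻¹) x) (inverseʳ x x≢0)

  x*y≡0⇒y≡0 : ∀ {x y} → x ≢ 0# → x * y ≡ 0# → y ≡ 0#
  x*y≡0⇒y≡0 {x} {y} x≢0 xy≡0 = begin
    y               ≡⟨ sym (*-identityˡ y) ⟩
    1# * y          ≡⟨ cong (_* y) (sym (x⁻¹*x≡1 x≢0)) ⟩
    (x ⁻¹ * x) * y  ≡⟨ *-assoc _ _ _ ⟩
    x ⁻¹ * (x * y)  ≡⟨ cong (x ⁻¹ *_) xy≡0 ⟩
    x ⁻¹ * 0#       ≡⟨ zeroʳ _ ⟩
    0#              ∎
    where open ≡-Reasoning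

  x*y≡0⇒x≡0⊎y≡0 : ∀ {x y} → x * y ≡ 0# → x ≡ 0# ⊎ y ≡ 0#
  x*y≡0⇒x≡0⊎y≡0 {x} xy≡0 with x ≟ 0#
  ... | yes x≡0 = inj₁ x≡0
  ... | no  x≢0 = inj₂ (x*y≡0⇒y≡0 x≢0 xy≡0)

  -- Translating by 1 permutes the field, so Σ (x + 1) = Σ x forces q · 1 = 0.
  q×1≡0 : (2 ^ r) ×′ 1# ≡ 0#
  q×1≡0 = begin
    (2 ^ r) ×′ 1#               ≡⟨ cong (_×′ 1#) (sym card) ⟩
    length elements ×′ 1#       ≡⟨ sym (∑-const elements 1#) ⟩
    ∑ elements (λ _ → 1#)      ≡⟨ identityʳ-unique _ _ ∑x+∑1≡∑x ⟩
    0#                         ∎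
    where
    open ≡-Reasoning
    ∑x+∑1≡∑x : ∑ elements (λ x → x) + ∑ elements (λ _ → 1#) ≡ ∑ elements (λ x → x)
    ∑x+∑1≡∑x = trans (sym (∑-∙ elements (λ x → x) (λ _ → 1#)))
      (∑-reindex (_+ 1#) (_+ - 1#)
        (λ y → trans (+-assoc y (- 1#) 1#) (trans (cong (y +_) (-‿inverseˡ 1#)) (+-identityʳ y)))
        (λ x → trans (+-assoc x 1# (- 1#)) (trans (cong (x +_) (-‿inverseʳ 1#)) (+-identityʳ x)))
        (λ x → x))

  2^n×1≡0⇒2×1≡0 : ∀ n → (2 ^ n) ×′ 1# ≡ 0# → 2 ×′ 1# ≡ 0#
  2^n×1≡0⇒2×1≡0 zero    1+0≡0 = contradiction (sym (trans (sym (+-identityʳ 1#)) 1+0≡0)) 0≢1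
  2^n×1≡0⇒2×1≡0 (suc n) eq with x*y≡0⇒x≡0⊎y≡0 (trans (sym (×1-homo-* 2 (2 ^ n))) eq)
  ... | inj₁ 2×1≡0 = 2×1≡0
  ... | inj₂ 2^n×1≡0 = 2^n×1≡0⇒2×1≡0 n 2^n×1≡0

  1+1≡0 : 1# + 1# ≡ 0#
  1+1≡0 = trans (cong (1# +_) (sym (+-identityʳ 1#))) (2^n×1≡0⇒2×1≡0 r q×1≡0)

  x+x≡0 : ∀ x → x + x ≡ 0#
  x+x≡0 x = begin
    x + x              ≡⟨ sym (cong₂ _+_ (*-identityˡ x) (*-identityˡ x)) ⟩
    1# * x + 1# * x    ≡⟨ sym (distribʳ x 1# 1#) ⟩
    (1# + 1#) * x      ≡⟨ cong (_* x) 1+1≡0 ⟩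
    0# * x             ≡⟨ zeroˡ x ⟩
    0#                 ∎
    where open ≡-Reasoning

  x+a+a≡x : ∀ a x → x + a + a ≡ x
  x+a+a≡x a x = trans (+-assoc x a a) (trans (cong (x +_) (x+x≡0 a)) (+-identityʳ x))

  x+y≡0⇒x≡y : ∀ {x y} → x + y ≡ 0# → x ≡ y
  x+y≡0⇒x≡y {x} {y} x+y≡0 = begin
    x              ≡⟨ sym (+-identityʳ x) ⟩
    x + 0#         ≡⟨ cong (x +_) (sym (x+x≡0 y)) ⟩
    x + (y + y)    ≡⟨ sym (+-assoc x y y) ⟩
    (x + y) + y    ≡⟨ cong (_+ y) x+y≡0 ⟩
    0# + y         ≡⟨ +-identityˡ y ⟩
    y              ∎
    where open ≡-Reasoning

  -- Ring solver with coefficients in 𝔽₂ = (Bool, xor, ∧): it normalises modulo x + x = 0.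
  𝔽₂ : RawRing 0ℓ 0ℓ
  𝔽₂ = record { Carrier = Bool ; _≈_ = _≡_ ; _+_ = _xor_ ; _*_ = _∧_ ; -_ = λ b → b ; 0# = false ; 1# = true }

  embed𝔽₂ : Bool → Carrier
  embed𝔽₂ true  = 1#
  embed𝔽₂ false = 0#

  embed𝔽₂-morphism : 𝔽₂ ACR.-Raw-AlmostCommutative⟶ ACR.fromCommutativeRing commutativeRing
  embed𝔽₂-morphism = record
    { ⟦_⟧    = embed𝔽₂
    ; +-homo = λ { true true → sym 1+1≡0 ; true false → sym (+-identityʳ 1#)
                 ; false true → sym (+-identityˡ 1#) ; false false → sym (+-identityˡ 0#) }
    ; *-homo = λ { true true → sym (*-identityˡ 1#) ; true false → sym (zeroʳ 1#)
                 ; false true → sym (zeroˡ 1#) ; false false → sym (zeroˡ 0#) }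
    ; -‿homo = λ { true → inverseˡ-unique 1# 1# 1+1≡0 ; false → sym ε⁻¹≈ε }
    ; 0-homo = refl
    ; 1-homo = refl
    }

  embed𝔽₂-≟ : ∀ a b → Maybe (embed𝔽₂ a ≡ embed𝔽₂ b)
  embed𝔽₂-≟ true  true  = just refl
  embed𝔽₂-≟ false false = just refl
  embed𝔽₂-≟ _     _     = nothing

  module 𝔽₂-Solver = Algebra.Solver.Ring 𝔽₂ (ACR.fromCommutativeRing commutativeRing) embed𝔽₂-morphism embed𝔽₂-≟
  open 𝔽₂-Solver using (solve; _:=_; _:+_; _:*_; con)

  1≢0 : 1# ≢ 0#
  1≢0 1≡0 = 0≢1 (sym 1≡0)

  proportional : ∀ {a e u v} → ¬ (a ≡ 0# × e ≡ 0#) → u * e ≡ v * a →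
    ∃ λ t → u ≡ t * a × v ≡ t * e
  proportional {a} {e} {u} {v} ae≢0 ue≡va with a ≟ 0#
  ... | no a≢0 = u * a ⁻¹ , sym u*a⁻¹*a≡u , sym u*a⁻¹*e≡v
    where
    open ≡-Reasoning
    u*a⁻¹*a≡u : u * a ⁻¹ * a ≡ u
    u*a⁻¹*a≡u = begin
      u * a ⁻¹ * a    ≡⟨ *-assoc u (a ⁻¹) a ⟩
      u * (a ⁻¹ * a)  ≡⟨ cong (u *_) (x⁻¹*x≡1 a≢0) ⟩
      u * 1#          ≡⟨ *-identityʳ u ⟩
      u               ∎
    u*a⁻¹*e≡v : u * a ⁻¹ * e ≡ v
    u*a⁻¹*e≡v = begin
      u * a ⁻¹ * e    ≡⟨ solve 3 (λ u i e → u :* i :* e := u :* e :* i) refl u (a ⁻¹) e ⟩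
      u * e * a ⁻¹    ≡⟨ cong (_* a ⁻¹) ue≡va ⟩
      v * a * a ⁻¹    ≡⟨ *-assoc v a (a ⁻¹) ⟩
      v * (a * a ⁻¹)  ≡⟨ cong (v *_) (inverseʳ a a≢0) ⟩
      v * 1#          ≡⟨ *-identityʳ v ⟩
      v               ∎
  ... | yes a≡0 = v * e ⁻¹ , u≡v*e⁻¹*a , sym v*e⁻¹*e≡v
    where
    e≢0 : e ≢ 0#
    e≢0 e≡0 = ae≢0 (a≡0 , e≡0)
    v*e⁻¹*e≡v : v * e ⁻¹ * e ≡ v
    v*e⁻¹*e≡v = trans (*-assoc v (e ⁻¹) e) (trans (cong (v *_) (x⁻¹*x≡1 e≢0)) (*-identityʳ v))
    u≡0 : u ≡ 0#
    u≡0 = x*y≡0⇒y≡0 e≢0 (trans (*-comm e u) (trans ue≡va (trans (cong (v *_) a≡0) (zeroʳ v))))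
    u≡v*e⁻¹*a : u ≡ v * e ⁻¹ * a
    u≡v*e⁻¹*a = trans u≡0 (sym (trans (cong (v * e ⁻¹ *_) a≡0) (zeroʳ _)))

  φ : Carrier → Carrier → Carrier
  φ β z = z * z + β * z

  φ-+ : ∀ β x z → φ β (x + z) ≡ φ β x + φ β z
  φ-+ β x z = solve 3 (λ β x z → (x :+ z) :* (x :+ z) :+ β :* (x :+ z) := (x :* x :+ β :* x) :+ (z :* z :+ β :* z))
                refl β x z

  φ-fibre : ∀ β {x y} → φ β y ≡ φ β x → y ≡ x ⊎ y ≡ x + β
  φ-fibre β {x} {y} φy≡φx with x*y≡0⇒x≡0⊎y≡0 [y+x]*[y+x+β]≡0
    where
    open ≡-Reasoning
    [y+x]*[y+x+β]≡0 : (y + x) * ((y + x) + β) ≡ 0#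
    [y+x]*[y+x+β]≡0 = begin
      (y + x) * ((y + x) + β)  ≡⟨ solve 3 (λ β x y → (y :+ x) :* ((y :+ x) :+ β) := (y :* y :+ β :* y) :+ (x :* x :+ β :* x))
                                    refl β x y ⟩
      φ β y + φ β x            ≡⟨ cong (_+ φ β x) φy≡φx ⟩
      φ β x + φ β x            ≡⟨ x+x≡0 _ ⟩
      0#                       ∎
  ... | inj₁ y+x≡0   = inj₁ (x+y≡0⇒x≡y y+x≡0)
  ... | inj₂ y+x+β≡0 = inj₂ (x+y≡0⇒x≡y (trans (sym (+-assoc y x β)) y+x+β≡0))

  -- A root w of z² + βz = cβ² would give the factorisation z² + z + c = (z + w/β)(z + w/β + 1).
  irreducible⇒φ≢cβ² : ∀ {c} → IrreducibleZ²+Z+ F c → ∀ {β} → β ≢ 0# → ∀ w → φ β w ≢ c * (β * β)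
  irreducible⇒φ≢cβ² {c} irreducible {β} β≢0 w φw≡cβ² =
    irreducible (1# , u , 1# , u + 1# , 1≢0 , 1≢0 , *-identityˡ 1# , middle , constant)
    where
    open ≡-Reasoning
    u = w * β ⁻¹
    β*β⁻¹≡1 : β * β ⁻¹ ≡ 1#
    β*β⁻¹≡1 = inverseʳ β β≢0
    middle : 1# * (u + 1#) + u * 1# ≡ 1#
    middle = solve 1 (λ u → con true :* (u :+ con true) :+ u :* con true := con true) refl u
    constant : u * (u + 1#) ≡ c
    constant = begin
      u * (u + 1#)                                   ≡⟨ cong (λ k → u * (u + k)) (sym β*β⁻¹≡1) ⟩
      w * β ⁻¹ * (w * β ⁻¹ + β * β ⁻¹)               ≡⟨ solve 3 (λ w i β → w :* i :* (w :* i :+ β :* i) := (w :* w :+ β :* w) :* (i :* i))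
                                                          refl w (β ⁻¹) β ⟩
      φ β w * (β ⁻¹ * β ⁻¹)                          ≡⟨ cong (_* (β ⁻¹ * β ⁻¹)) φw≡cβ² ⟩
      c * (β * β) * (β ⁻¹ * β ⁻¹)                    ≡⟨ solve 3 (λ c β i → c :* (β :* β) :* (i :* i) := c :* ((β :* i) :* (β :* i)))
                                                          refl c β (β ⁻¹) ⟩
      c * ((β * β ⁻¹) * (β * β ⁻¹))                  ≡⟨ cong (λ k → c * (k * k)) β*β⁻¹≡1 ⟩
      c * (1# * 1#)                                  ≡⟨ solve 1 (λ c → c :* (con true :* con true) := c) refl c ⟩
      c                                              ∎

module OrthogonalGroup {r : ℕ} (F : FiniteField r) (c : FiniteField.Carrier F) where

  open FiniteField F
  open FieldProperties F
  open 𝔽₂-Solver using (solve; _:=_; _:+_; _:*_; con)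
  open IsCommutativeRing isCommutativeRing using (*-identityʳ; zeroˡ; zeroʳ)

  θ-apply : ∀ a b e f x₁ x₂ → θ F c (apply F (a , b , e , f) (x₁ , x₂)) ≡
    x₁ * x₁ * θ F c (a , e) + x₂ * x₂ * θ F c (b , f) + x₁ * x₂ * (a * f + b * e)
  θ-apply a b e f x₁ x₂ = solve 7 (λ c a b e f x₁ x₂ →
      (a :* x₁ :+ b :* x₂) :* (a :* x₁ :+ b :* x₂) :+ (a :* x₁ :+ b :* x₂) :* (e :* x₁ :+ f :* x₂)
        :+ c :* ((e :* x₁ :+ f :* x₂) :* (e :* x₁ :+ f :* x₂))
      := x₁ :* x₁ :* (a :* a :+ a :* e :+ c :* (e :* e)) :+ x₂ :* x₂ :* (b :* b :+ b :* f :+ c :* (f :* f))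
           :+ x₁ :* x₂ :* (a :* f :+ b :* e))
    refl c a b e f x₁ x₂

  -- θ and its polar form take the same values on the columns of M as on the standard basis.
  OrthogonalColumns : Mat₂ F → Set
  OrthogonalColumns (a , b , e , f) = θ F c (a , e) ≡ 1# × θ F c (b , f) ≡ c × a * f + b * e ≡ 1#

  orthogonalColumns⇒InO⁻ : ∀ M → OrthogonalColumns M → InO⁻ F c M
  orthogonalColumns⇒InO⁻ (a , b , e , f) (θ₁ , θ₂ , polar) = All.tabulate λ { {x₁ , x₂} _ → begin
      θ F c (apply F (a , b , e , f) (x₁ , x₂))
        ≡⟨ θ-apply a b e f x₁ x₂ ⟩
      x₁ * x₁ * θ F c (a , e) + x₂ * x₂ * θ F c (b , f) + x₁ * x₂ * (a * f + b * e)
        ≡⟨ cong₂ (λ u v → x₁ * x₁ * u + x₂ * x₂ * v + x₁ * x₂ * (a * f + b * e)) θ₁ θ₂ ⟩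
      x₁ * x₁ * 1# + x₂ * x₂ * c + x₁ * x₂ * (a * f + b * e)
        ≡⟨ cong (λ u → x₁ * x₁ * 1# + x₂ * x₂ * c + x₁ * x₂ * u) polar ⟩
      x₁ * x₁ * 1# + x₂ * x₂ * c + x₁ * x₂ * 1#
        ≡⟨ solve 3 (λ c x₁ x₂ → x₁ :* x₁ :* con true :+ x₂ :* x₂ :* c :+ x₁ :* x₂ :* con true
                                  := x₁ :* x₁ :+ x₁ :* x₂ :+ c :* (x₂ :* x₂)) refl c x₁ x₂ ⟩
      θ F c (x₁ , x₂) ∎ }
    where open ≡-Reasoning

  InO⁻⇒orthogonalColumns : ∀ M → InO⁻ F c M → OrthogonalColumns M
  InO⁻⇒orthogonalColumns (a , b , e , f) M∈O⁻ = θ₁ , θ₂ , polar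
    where
    open ≡-Reasoning
    θ₁′ θ₂′ polar′ : Carrier
    θ₁′    = θ F c (a , e)
    θ₂′    = θ F c (b , f)
    polar′ = a * f + b * e
    θ[Mx]≡θ[x] : ∀ x₁ x₂ → x₁ * x₁ * θ₁′ + x₂ * x₂ * θ₂′ + x₁ * x₂ * polar′ ≡ θ F c (x₁ , x₂)
    θ[Mx]≡θ[x] x₁ x₂ = trans (sym (θ-apply a b e f x₁ x₂))
                              (All.lookup M∈O⁻ (∈-cartesianProduct⁺ (complete x₁) (complete x₂)))
    θ₁ : θ₁′ ≡ 1#
    θ₁ = begin
      θ₁′                                                        ≡⟨ solve 3 (λ p q s → p := con true :* con true :* p
                                                                      :+ con false :* con false :* q :+ con true :* con false :* s)
                                                                      refl θ₁′ θ₂′ polar′ ⟩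
      1# * 1# * θ₁′ + 0# * 0# * θ₂′ + 1# * 0# * polar′           ≡⟨ θ[Mx]≡θ[x] 1# 0# ⟩
      θ F c (1# , 0#)                                            ≡⟨ solve 1 (λ c → con true :* con true :+ con true :* con false
                                                                      :+ c :* (con false :* con false) := con true) refl c ⟩
      1#                                                         ∎
    θ₂ : θ₂′ ≡ c
    θ₂ = begin
      θ₂′                                                        ≡⟨ solve 3 (λ p q s → q := con false :* con false :* p
                                                                      :+ con true :* con true :* q :+ con false :* con true :* s)
                                                                      refl θ₁′ θ₂′ polar′ ⟩
      0# * 0# * θ₁′ + 1# * 1# * θ₂′ + 0# * 1# * polar′           ≡⟨ θ[Mx]≡θ[x] 0# 1# ⟩
      θ F c (0# , 1#)                                            ≡⟨ solve 1 (λ c → con false :* con false :+ con false :* con true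
                                                                      :+ c :* (con true :* con true) := c) refl c ⟩
      c                                                          ∎
    polar : polar′ ≡ 1#
    polar = begin
      polar′                                                     ≡⟨ solve 3 (λ p q s → s := con true :* con true :* p
                                                                      :+ con true :* con true :* q :+ con true :* con true :* s :+ (p :+ q))
                                                                      refl θ₁′ θ₂′ polar′ ⟩
      1# * 1# * θ₁′ + 1# * 1# * θ₂′ + 1# * 1# * polar′ + (θ₁′ + θ₂′)
                                                                 ≡⟨ cong₂ _+_ (θ[Mx]≡θ[x] 1# 1#) (cong₂ _+_ θ₁ θ₂) ⟩
      θ F c (1# , 1#) + (1# + c)                                 ≡⟨ solve 1 (λ c → (con true :* con true :+ con true :* con true
                                                                      :+ c :* (con true :* con true)) :+ (con true :+ c) := con true) refl c ⟩
      1#                                                         ∎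

  -- InSO⁻ F c is definitionally Parametrised (λ a e → c * e) (λ a e → a + e).
  Parametrised : (Carrier → Carrier → Carrier) → (Carrier → Carrier → Carrier) → Mat₂ F → Set
  Parametrised b f (m₁₁ , m₁₂ , m₂₁ , m₂₂) = m₁₂ ≡ b m₁₁ m₂₁ × m₂₂ ≡ f m₁₁ m₂₁ × θ F c (m₁₁ , m₂₁) ≡ 1#

  Parametrised? : ∀ b f M → Dec (Parametrised b f M)
  Parametrised? b f (m₁₁ , m₁₂ , m₂₁ , m₂₂) =
    (m₁₂ ≟ b m₁₁ m₂₁) ×-dec (m₂₂ ≟ f m₁₁ m₂₁) ×-dec (θ F c (m₁₁ , m₂₁) ≟ 1#)

  InReflection : Mat₂ F → Set
  InReflection = Parametrised (λ a e → c * e + a) (λ a e → a)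

  InReflection? : ∀ M → Dec (InReflection M)
  InReflection? = Parametrised? (λ a e → c * e + a) (λ a e → a)

  InSO⁻⇒InO⁻ : ∀ M → InSO⁻ F c M → InO⁻ F c M
  InSO⁻⇒InO⁻ (a , _ , e , _) (refl , refl , θ₁) = orthogonalColumns⇒InO⁻ (a , c * e , e , a + e) (θ₁ , θ₂ , polar)
    where
    θ₂ : θ F c (c * e , a + e) ≡ c
    θ₂ = trans (solve 3 (λ c a e → (c :* e) :* (c :* e) :+ (c :* e) :* (a :+ e) :+ c :* ((a :+ e) :* (a :+ e))
                                    := c :* (a :* a :+ a :* e :+ c :* (e :* e))) refl c a e)
           (trans (cong (c *_) θ₁) (*-identityʳ c))
    polar : a * (a + e) + c * e * e ≡ 1#
    polar = trans (solve 3 (λ c a e → a :* (a :+ e) :+ c :* e :* e := a :* a :+ a :* e :+ c :* (e :* e)) refl c a e) θ₁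

  InReflection⇒InO⁻ : ∀ M → InReflection M → InO⁻ F c M
  InReflection⇒InO⁻ (a , _ , e , _) (refl , refl , θ₁) = orthogonalColumns⇒InO⁻ (a , c * e + a , e , a) (θ₁ , θ₂ , polar)
    where
    θ₂ : θ F c (c * e + a , a) ≡ c
    θ₂ = trans (solve 3 (λ c a e → (c :* e :+ a) :* (c :* e :+ a) :+ (c :* e :+ a) :* a :+ c :* (a :* a)
                                    := c :* (a :* a :+ a :* e :+ c :* (e :* e))) refl c a e)
           (trans (cong (c *_) θ₁) (*-identityʳ c))
    polar : a * a + (c * e + a) * e ≡ 1#
    polar = trans (solve 3 (λ c a e → a :* a :+ (c :* e :+ a) :* e := a :* a :+ a :* e :+ c :* (e :* e)) refl c a e) θ₁

  θ≡1⇒≢0 : ∀ {a e} → θ F c (a , e) ≡ 1# → ¬ (a ≡ 0# × e ≡ 0#)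
  θ≡1⇒≢0 θ≡1 (refl , refl) = 1≢0 (trans (sym θ≡1)
    (solve 1 (λ c → con false :* con false :+ con false :* con false :+ c :* (con false :* con false) := con false) refl c))

  InSO⁻⇒¬InReflection : ∀ M → InSO⁻ F c M → ¬ InReflection M
  InSO⁻⇒¬InReflection (a , _ , e , _) (refl , refl , θ₁) (ce≡ce+a , a+e≡a , _) =
    θ≡1⇒≢0 θ₁ (a≡0 , e≡0)
    where
    a≡0 : a ≡ 0#
    a≡0 = trans (solve 2 (λ a ce → a := ce :+ (ce :+ a)) refl a (c * e)) (trans (cong (_+ (c * e + a)) ce≡ce+a) (x+x≡0 _))
    e≡0 : e ≡ 0#
    e≡0 = trans (solve 2 (λ a e → e := (a :+ e) :+ a) refl a e) (trans (cong (_+ a) a+e≡a) (x+x≡0 a))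

  -- The second column (b, f) satisfies a f + b e = θ(a, e), as does (c e, a + e); so their difference is
  -- orthogonal to (a, e), i.e. a multiple t (a, e), and θ(b, f) = c forces t² + t = 0.
  orthogonalColumns⇒InSO⁻⊎InReflection : ∀ M → OrthogonalColumns M → InSO⁻ F c M ⊎ InReflection M
  orthogonalColumns⇒InSO⁻⊎InReflection (a , b , e , f) (θ₁ , θ₂ , polar) with proportional (θ≡1⇒≢0 θ₁) ue≡va
    where
    ue≡va : (b + c * e) * e ≡ (f + (a + e)) * a
    ue≡va = x+y≡0⇒x≡y (begin
      (b + c * e) * e + (f + (a + e)) * a
        ≡⟨ solve 5 (λ c a b e f → (b :+ c :* e) :* e :+ (f :+ (a :+ e)) :* a
                                  := (a :* f :+ b :* e) :+ (a :* a :+ a :* e :+ c :* (e :* e))) refl c a b e f ⟩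
      (a * f + b * e) + θ F c (a , e)   ≡⟨ cong₂ _+_ polar θ₁ ⟩
      1# + 1#                           ≡⟨ 1+1≡0 ⟩
      0#                                ∎)
      where open ≡-Reasoning
  ... | t , u≡ta , v≡te = [ (λ t≡0 → inj₁ (t≡0⇒InSO⁻ t≡0)) , (λ t+1≡0 → inj₂ (t≡1⇒InReflection (x+y≡0⇒x≡y t+1≡0))) ]′
                             (x*y≡0⇒x≡0⊎y≡0 t*[t+1]≡0)
    where
    open ≡-Reasoning
    b≡ce+ta : b ≡ c * e + t * a
    b≡ce+ta = trans (solve 3 (λ b c e → b := c :* e :+ (b :+ c :* e)) refl b c e) (cong (c * e +_) u≡ta)
    f≡a+e+te : f ≡ (a + e) + t * e
    f≡a+e+te = trans (solve 3 (λ a e f → f := (a :+ e) :+ (f :+ (a :+ e))) refl a e f) (cong ((a + e) +_) v≡te)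
    t*[t+1]≡0 : t * (t + 1#) ≡ 0#
    t*[t+1]≡0 = begin
      t * (t + 1#)                                   ≡⟨ solve 2 (λ t c → t :* (t :+ con true) := (c :+ t :+ t :* t) :* con true :+ c) refl t c ⟩
      (c + t + t * t) * 1# + c                       ≡⟨ cong (λ k → (c + t + t * t) * k + c) (sym θ₁) ⟩
      (c + t + t * t) * θ F c (a , e) + c            ≡⟨ cong (_+ c) (solve 4 (λ c t a e →
                                                          (c :+ t :+ t :* t) :* (a :* a :+ a :* e :+ c :* (e :* e))
                                                          := (c :* e :+ t :* a) :* (c :* e :+ t :* a) :+ (c :* e :+ t :* a) :* ((a :+ e) :+ t :* e)
                                                             :+ c :* (((a :+ e) :+ t :* e) :* ((a :+ e) :+ t :* e))) refl c t a e) ⟩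
      θ F c (c * e + t * a , (a + e) + t * e) + c    ≡⟨ cong (_+ c) (cong₂ (λ x y → θ F c (x , y)) (sym b≡ce+ta) (sym f≡a+e+te)) ⟩
      θ F c (b , f) + c                              ≡⟨ cong (_+ c) θ₂ ⟩
      c + c                                          ≡⟨ x+x≡0 c ⟩
      0#                                             ∎
    t≡0⇒InSO⁻ : t ≡ 0# → InSO⁻ F c (a , b , e , f)
    t≡0⇒InSO⁻ t≡0 =
        trans b≡ce+ta (trans (cong (λ s → c * e + s * a) t≡0) (solve 3 (λ c e a → c :* e :+ con false :* a := c :* e) refl c e a))
      , trans f≡a+e+te (trans (cong (λ s → (a + e) + s * e) t≡0) (solve 2 (λ a e → (a :+ e) :+ con false :* e := a :+ e) refl a e))
      , θ₁
    t≡1⇒InReflection : t ≡ 1# → InReflection (a , b , e , f)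
    t≡1⇒InReflection t≡1 =
        trans b≡ce+ta (trans (cong (λ s → c * e + s * a) t≡1) (solve 3 (λ c e a → c :* e :+ con true :* a := c :* e :+ a) refl c e a))
      , trans f≡a+e+te (trans (cong (λ s → (a + e) + s * e) t≡1) (solve 2 (λ a e → (a :+ e) :+ con true :* e := a) refl a e))
      , θ₁

  InO⁻⇒InSO⁻⊎InReflection : ∀ M → InO⁻ F c M → InSO⁻ F c M ⊎ InReflection M
  InO⁻⇒InSO⁻⊎InReflection M M∈O⁻ = orthogonalColumns⇒InSO⁻⊎InReflection M (InO⁻⇒orthogonalColumns M M∈O⁻)

module IntegerSums where

  open import Data.Integer using (+_; _+_; _*_; _≤_)
  open BigOperators ℤP.+-0-isCommutativeMonoid public

  ∑-1≡length : {X : Set} (xs : List X) → ∑ xs (λ _ → 1ℤ) ≡ + length xs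
  ∑-1≡length []       = refl
  ∑-1≡length (x ∷ xs) = trans (cong (_+_ 1ℤ) (∑-1≡length xs)) (sym (ℤP.pos-+ 1 (length xs)))

  ∑-*ʳ : {X : Set} (xs : List X) (f : X → ℤ) (v : ℤ) → ∑ xs (λ x → f x * v) ≡ ∑ xs f * v
  ∑-*ʳ []       f v = sym (ℤP.*-zeroˡ v)
  ∑-*ʳ (x ∷ xs) f v = trans (cong (_+_ (f x * v)) (∑-*ʳ xs f v)) (sym (ℤP.*-distribʳ-+ v (f x) (∑ xs f)))

  when≡when1* : {P : Set} (p : Dec P) (v : ℤ) → when p v ≡ when p 1ℤ * v
  when≡when1* (yes _) v = sym (ℤP.*-identityˡ v)
  when≡when1* (no _)  v = sym (ℤP.*-zeroˡ v)

  ∑-when≡count* : {X : Set} {P : X → Set} (P? : Decidable P) (xs : List X) (v : ℤ) →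
    ∑ xs (λ x → when (P? x) v) ≡ ∑ xs (λ x → when (P? x) 1ℤ) * v
  ∑-when≡count* P? xs v = trans (∑-cong xs (λ x → when≡when1* (P? x) v)) (∑-*ʳ xs _ v)

  when1≥0 : {P : Set} (p : Dec P) → 0ℤ ≤ when p 1ℤ
  when1≥0 (yes _) = ℤ.+≤+ ℕ.z≤n
  when1≥0 (no _)  = ℤP.≤-refl

  when1≤when1+when1 : {P Q R : Set} (p : Dec P) (q : Dec Q) (r : Dec R) → (P → Q ⊎ R) →
    when p 1ℤ ≤ when q 1ℤ + when r 1ℤ
  when1≤when1+when1 (no _)  q       r       _  = ℤP.+-mono-≤ (when1≥0 q) (when1≥0 r)
  when1≤when1+when1 (yes p) (yes _) r       _  = ℤP.≤-trans (ℤP.≤-reflexive (sym (ℤP.+-identityʳ 1ℤ)))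
                                                    (ℤP.+-monoʳ-≤ 1ℤ (when1≥0 r))
  when1≤when1+when1 (yes p) (no _)  (yes _) _  = ℤP.≤-reflexive (sym (ℤP.+-identityˡ 1ℤ))
  when1≤when1+when1 (yes p) (no ¬q) (no ¬r) p⇒ = [ (λ q → contradiction q ¬q) , (λ r → contradiction r ¬r) ]′ (p⇒ p)

  ∑-mono-≤ : {X : Set} (xs : List X) {f g : X → ℤ} → (∀ x → f x ≤ g x) → ∑ xs f ≤ ∑ xs g
  ∑-mono-≤ []       f≤g = ℤP.≤-refl
  ∑-mono-≤ (x ∷ xs) f≤g = ℤP.+-mono-≤ (f≤g x) (∑-mono-≤ xs f≤g)

  +-≤-≤-≡⇒≡ : ∀ {a b c d} → a ≤ b → c ≤ d → a + c ≡ b + d → a ≡ b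
  +-≤-≤-≡⇒≡ {a} {b} a≤b c≤d a+c≡b+d with a ℤ.≟ b
  ... | yes a≡b = a≡b
  ... | no  a≢b = contradiction (ℤP.+-mono-<-≤ (ℤP.≤∧≢⇒< a≤b a≢b) c≤d) (ℤP.<-irrefl a+c≡b+d)

  ∑-≤-≡⇒≡ : {X : Set} (xs : List X) {f g : X → ℤ} → (∀ x → f x ≤ g x) → ∑ xs f ≡ ∑ xs g →
    ∀ {x} → x ∈ xs → f x ≡ g x
  ∑-≤-≡⇒≡ (y ∷ xs) f≤g ∑f≡∑g (here refl) = +-≤-≤-≡⇒≡ (f≤g y) (∑-mono-≤ xs f≤g) ∑f≡∑g
  ∑-≤-≡⇒≡ (y ∷ xs) {f} {g} f≤g ∑f≡∑g (there x∈xs) =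
    ∑-≤-≡⇒≡ xs f≤g (+-≤-≤-≡⇒≡ (∑-mono-≤ xs f≤g) (f≤g y)
      (trans (ℤP.+-comm (∑ xs f) (f y)) (trans ∑f≡∑g (ℤP.+-comm (g y) (∑ xs g))))) x∈xs

module RootCounts {r : ℕ} (F : FiniteField r) where

  open FiniteField F
  open FieldProperties F
  open IntegerSums
  open 𝔽₂-Solver using (solve; _:=_; _:+_; _:*_; con)
  open Enumeration _≟_ elements unique complete
  open IsCommutativeRing isCommutativeRing using (+-assoc; +-identityˡ; +-identityʳ)

  q : ℤ
  q = ∑ elements (λ _ → 1ℤ)

  q≡2^r : q ≡ ℤ.+ (2 ^ r)
  q≡2^r = trans (∑-1≡length elements) (cong ℤ.+_ card)

  rootCount : Carrier → Carrier → ℤ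
  rootCount β d = ∑ elements (λ z → when (φ β z ≟ d) 1ℤ)

  root? : ∀ β d → Dec (∃ λ x → φ β x ≡ d)
  root? β d = Dec.map′ satisfied (λ (x , φx≡d) → lose (complete x) φx≡d) (any? (λ z → φ β z ≟ d) elements)

  rootCount-noRoot : ∀ {β d} → ¬ (∃ λ x → φ β x ≡ d) → rootCount β d ≡ 0ℤ
  rootCount-noRoot {β} {d} noRoot =
    trans (∑-cong elements (λ z → when-no (φ β z ≟ d) (λ φz≡d → noRoot (z , φz≡d)) 1ℤ)) (∑-ε elements)

  rootCount-root≤2 : ∀ {β d x} → φ β x ≡ d → rootCount β d ℤ.≤ ℤ.+ 2
  rootCount-root≤2 {β} {d} {x} φx≡d = ℤP.≤-trans (∑-mono-≤ elements pointwise) (ℤP.≤-reflexive ∑δ+∑δ≡2)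
    where
    pointwise : ∀ z → when (φ β z ≟ d) 1ℤ ℤ.≤ when (z ≟ x) 1ℤ ℤ.+ when (z ≟ x + β) 1ℤ
    pointwise z = when1≤when1+when1 (φ β z ≟ d) (z ≟ x) (z ≟ x + β) (λ φz≡d → φ-fibre β (trans φz≡d (sym φx≡d)))
    ∑δ+∑δ≡2 : ∑ elements (λ z → when (z ≟ x) 1ℤ ℤ.+ when (z ≟ x + β) 1ℤ) ≡ ℤ.+ 2
    ∑δ+∑δ≡2 = trans (∑-∙ elements _ _) (cong₂ ℤ._+_ (∑-δ x (λ _ → 1ℤ)) (∑-δ (x + β) (λ _ → 1ℤ)))

  rootCount≤2 : ∀ β d → rootCount β d ℤ.≤ ℤ.+ 2
  rootCount≤2 β d with root? β d
  ... | yes (x , φx≡d) = rootCount-root≤2 φx≡d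
  ... | no  noRoot     = ℤP.≤-trans (ℤP.≤-reflexive (rootCount-noRoot noRoot)) (ℤ.+≤+ ℕ.z≤n)

  ∑-rootCount : ∀ β → ∑ elements (rootCount β) ≡ q
  ∑-rootCount β = trans (∑-comm elements elements (λ d z → when (φ β z ≟ d) 1ℤ))
                        (∑-cong elements (λ z → ∑-δ′ (φ β z) (λ _ → 1ℤ)))

  φ0[1]≡1 : φ 0# 1# ≡ 1#
  φ0[1]≡1 = solve 0 (con true :* con true :+ con false :* con true := con true) refl

  φ0≡1⇒≡1 : ∀ z → φ 0# z ≡ 1# → z ≡ 1#
  φ0≡1⇒≡1 z φ0z≡1 with φ-fibre 0# {1#} {z} (trans φ0z≡1 (sym φ0[1]≡1))
  ... | inj₁ z≡1   = z≡1
  ... | inj₂ z≡1+0 = trans z≡1+0 (+-identityʳ 1#)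

  rootCount-0-1 : rootCount 0# 1# ≡ 1ℤ
  rootCount-0-1 = trans (∑-cong elements (λ z → when-cong (φ 0# z ≟ 1#) (z ≟ 1#) (φ0≡1⇒≡1 z) (λ { refl → φ0[1]≡1 }) 1ℤ))
                        (∑-δ 1# (λ _ → 1ℤ))

  module _ {c : Carrier} (irreducible : IrreducibleZ²+Z+ F c) {β : Carrier} (β≢0 : β ≢ 0#) where

    γ : Carrier
    γ = c * (β * β)

    -- A root x over d and a root z over d + γ would give the root x + z over γ.
    rootCount+rootCount-shift≤2 : ∀ d → rootCount β d ℤ.+ rootCount β (d + γ) ℤ.≤ ℤ.+ 2
    rootCount+rootCount-shift≤2 d with root? β d
    ... | no noRoot = ℤP.≤-trans (ℤP.≤-reflexive (trans (cong (ℤ._+ rootCount β (d + γ)) (rootCount-noRoot noRoot))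
                                                       (ℤP.+-identityˡ _)))
                                 (rootCount≤2 β (d + γ))
    ... | yes (x , φx≡d) = ℤP.≤-trans (ℤP.≤-reflexive (trans (cong (ℤ._+_ (rootCount β d)) (rootCount-noRoot noRoot))
                                                            (ℤP.+-identityʳ _)))
                                      (rootCount-root≤2 φx≡d)
      where
      noRoot : ¬ (∃ λ z → φ β z ≡ d + γ)
      noRoot (z , φz≡d+γ) = irreducible⇒φ≢cβ² irreducible β≢0 (x + z) (begin
        φ β (x + z)        ≡⟨ φ-+ β x z ⟩
        φ β x + φ β z      ≡⟨ cong₂ _+_ φx≡d φz≡d+γ ⟩
        d + (d + γ)        ≡⟨ sym (+-assoc d d γ) ⟩
        (d + d) + γ        ≡⟨ cong (_+ γ) (x+x≡0 d) ⟩
        0# + γ             ≡⟨ +-identityˡ γ ⟩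
        γ                  ∎)
        where open ≡-Reasoning

    -- Both sides sum to 2q over d, and the inequality above holds pointwise.
    rootCount+rootCount-shift≡2 : ∀ d → rootCount β d ℤ.+ rootCount β (d + γ) ≡ ℤ.+ 2
    rootCount+rootCount-shift≡2 d =
      ∑-≤-≡⇒≡ elements rootCount+rootCount-shift≤2 ∑[N+Nshift]≡∑2 (complete d)
      where
      ∑[N+Nshift]≡∑2 : ∑ elements (λ d → rootCount β d ℤ.+ rootCount β (d + γ)) ≡ ∑ elements (λ _ → ℤ.+ 2)
      ∑[N+Nshift]≡∑2 = begin
        ∑ elements (λ d → rootCount β d ℤ.+ rootCount β (d + γ))          ≡⟨ ∑-∙ elements _ _ ⟩
        ∑ elements (rootCount β) ℤ.+ ∑ elements (λ d → rootCount β (d + γ)) ≡⟨ cong (ℤ._+_ (∑ elements (rootCount β)))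
                                                                               (∑-reindex (_+ γ) (_+ γ) (x+a+a≡x γ) (x+a+a≡x γ) (rootCount β)) ⟩
        ∑ elements (rootCount β) ℤ.+ ∑ elements (rootCount β)             ≡⟨ cong₂ ℤ._+_ (∑-rootCount β) (∑-rootCount β) ⟩
        q ℤ.+ q                                                           ≡⟨ sym (∑-∙ elements _ _) ⟩
        ∑ elements (λ _ → ℤ.+ 2)                                          ∎
        where open ≡-Reasoning

module NormCounts {r : ℕ} (F : FiniteField r) (c : FiniteField.Carrier F) (irreducible : IrreducibleZ²+Z+ F c) where

  open FiniteField F
  open FieldProperties F
  open IntegerSums
  open Enumeration _≟_ elements unique complete
  open RootCounts F
  open IsCommutativeRing isCommutativeRing using (*-identityʳ)

  normOneCount : Carrier → ℤ
  normOneCount β = ∑ elements (λ a → when (θ F c (a , β) ≟ 1#) 1ℤ)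

  inverseSumCount : Carrier → ℤ
  inverseSumCount β = ∑ elements (λ α → when (¬? (α ≟ 0#)) (when (β ≟ α + 1# * α ⁻¹) 1ℤ))

  normOneCount≡rootCount : ∀ β → normOneCount β ≡ rootCount β (1# + c * (β * β))
  normOneCount≡rootCount β = ∑-cong elements (λ a → when-cong (θ F c (a , β) ≟ 1#) (φ β a ≟ 1# + c * (β * β))
    (λ θ≡1 → trans (solve 3 (λ a β c → a :* a :+ β :* a := (a :* a :+ a :* β :+ c :* (β :* β)) :+ c :* (β :* β)) refl a β c)
                   (cong (_+ c * (β * β)) θ≡1))
    (λ φ≡ → trans (solve 3 (λ a β c → a :* a :+ a :* β :+ c :* (β :* β) := (a :* a :+ β :* a) :+ c :* (β :* β)) refl a β c)
                  (trans (cong (_+ c * (β * β)) φ≡)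
                         (solve 2 (λ c β → (con true :+ c :* (β :* β)) :+ c :* (β :* β) := con true) refl c β)))
    1ℤ)
    where open 𝔽₂-Solver using (solve; _:=_; _:+_; _:*_; con)

  inverseSumCount≡rootCount : ∀ β → inverseSumCount β ≡ rootCount β 1#
  inverseSumCount≡rootCount β = ∑-cong elements (λ α →
    trans (sym (when-× (¬? (α ≟ 0#)) (β ≟ α + 1# * α ⁻¹) 1ℤ))
          (when-cong (¬? (α ≟ 0#) ×-dec (β ≟ α + 1# * α ⁻¹)) (φ β α ≟ 1#) (sum⇒root α) (root⇒sum α) 1ℤ))
    where
    open ≡-Reasoning
    open 𝔽₂-Solver using (solve; _:=_; _:+_; _:*_; con)
    sum⇒root : ∀ α → α ≢ 0# × β ≡ α + 1# * α ⁻¹ → φ β α ≡ 1#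
    sum⇒root α (α≢0 , β≡α+α⁻¹) = begin
      α * α + β * α                  ≡⟨ cong (λ k → α * α + k * α) β≡α+α⁻¹ ⟩
      α * α + (α + 1# * α ⁻¹) * α    ≡⟨ solve 2 (λ α i → α :* α :+ (α :+ con true :* i) :* α := α :* i) refl α (α ⁻¹) ⟩
      α * α ⁻¹                       ≡⟨ inverseʳ α α≢0 ⟩
      1#                             ∎
    root⇒sum : ∀ α → φ β α ≡ 1# → α ≢ 0# × β ≡ α + 1# * α ⁻¹
    root⇒sum α φα≡1 = α≢0 , (begin
      β                                        ≡⟨ sym (*-identityʳ β) ⟩
      β * 1#                                   ≡⟨ cong (β *_) (sym (inverseʳ α α≢0)) ⟩
      β * (α * α ⁻¹)                           ≡⟨ solve 3 (λ β α i → β :* (α :* i) := α :* (α :* i) :+ (α :* α :+ β :* α) :* i)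
                                                    refl β α (α ⁻¹) ⟩
      α * (α * α ⁻¹) + φ β α * α ⁻¹            ≡⟨ cong₂ (λ k m → α * k + m * α ⁻¹) (inverseʳ α α≢0) φα≡1 ⟩
      α * 1# + 1# * α ⁻¹                       ≡⟨ cong (_+ 1# * α ⁻¹) (*-identityʳ α) ⟩
      α + 1# * α ⁻¹                            ∎)
      where
      α≢0 : α ≢ 0#
      α≢0 α≡0 = 1≢0 (trans (sym φα≡1) (trans (cong (φ β) α≡0)
                  (solve 1 (λ β → con false :* con false :+ β :* con false := con false) refl β)))

  normOneCount+inverseSumCount≡2 : ∀ β → normOneCount β ℤ.+ inverseSumCount β ≡ ℤ.+ 2
  normOneCount+inverseSumCount≡2 β with β ≟ 0#
  ... | no β≢0 = begin
    normOneCount β ℤ.+ inverseSumCount β                ≡⟨ cong₂ ℤ._+_ (normOneCount≡rootCount β) (inverseSumCount≡rootCount β) ⟩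
    rootCount β (1# + c * (β * β)) ℤ.+ rootCount β 1#   ≡⟨ ℤP.+-comm (rootCount β (1# + c * (β * β))) (rootCount β 1#) ⟩
    rootCount β 1# ℤ.+ rootCount β (1# + c * (β * β))   ≡⟨ rootCount+rootCount-shift≡2 irreducible β≢0 1# ⟩
    ℤ.+ 2                                               ∎
    where open ≡-Reasoning
  ... | yes refl = begin
    normOneCount 0# ℤ.+ inverseSumCount 0#              ≡⟨ cong₂ ℤ._+_ (normOneCount≡rootCount 0#) (inverseSumCount≡rootCount 0#) ⟩
    rootCount 0# (1# + c * (0# * 0#)) ℤ.+ rootCount 0# 1#
      ≡⟨ cong (λ d → rootCount 0# d ℤ.+ rootCount 0# 1#)
              (solve 1 (λ c → con true :+ c :* (con false :* con false) := con true) refl c) ⟩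
    rootCount 0# 1# ℤ.+ rootCount 0# 1#                 ≡⟨ cong₂ ℤ._+_ rootCount-0-1 rootCount-0-1 ⟩
    ℤ.+ 2                                               ∎
    where
    open ≡-Reasoning
    open 𝔽₂-Solver using (solve; _:=_; _:+_; _:*_; con)

  ∑-inverseSumCount : ∑ elements inverseSumCount ℤ.+ 1ℤ ≡ q
  ∑-inverseSumCount = begin
    ∑ elements inverseSumCount ℤ.+ 1ℤ
      ≡⟨ cong (ℤ._+ 1ℤ) (∑-comm elements elements _) ⟩
    ∑ elements (λ α → ∑ elements (λ β → when (¬? (α ≟ 0#)) (when (β ≟ α + 1# * α ⁻¹) 1ℤ))) ℤ.+ 1ℤ
      ≡⟨ cong (ℤ._+ 1ℤ) (∑-cong elements (λ α → trans (∑-when elements (¬? (α ≟ 0#)) _)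
                                                        (cong (when (¬? (α ≟ 0#))) (∑-δ (α + 1# * α ⁻¹) (λ _ → 1ℤ))))) ⟩
    ∑ elements (λ α → when (¬? (α ≟ 0#)) 1ℤ) ℤ.+ 1ℤ
      ≡⟨ cong (ℤ._+_ (∑ elements (λ α → when (¬? (α ≟ 0#)) 1ℤ))) (sym (∑-δ 0# (λ _ → 1ℤ))) ⟩
    ∑ elements (λ α → when (¬? (α ≟ 0#)) 1ℤ) ℤ.+ ∑ elements (λ α → when (α ≟ 0#) 1ℤ)
      ≡⟨ sym (∑-∙ elements _ _) ⟩
    ∑ elements (λ α → when (¬? (α ≟ 0#)) 1ℤ ℤ.+ when (α ≟ 0#) 1ℤ)
      ≡⟨ ∑-cong elements (λ α → when-¬?∙when (α ≟ 0#) 1ℤ) ⟩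
    q ∎
    where open ≡-Reasoning

  ∑-normOneCount : ∑ elements normOneCount ≡ q ℤ.+ 1ℤ
  ∑-normOneCount = begin
    ∑ elements normOneCount
      ≡⟨ solve 2 (λ a b → a := (a :+ b) :- (b :+ con 1ℤ) :+ con 1ℤ) refl (∑ elements normOneCount) (∑ elements inverseSumCount) ⟩
    (∑ elements normOneCount ℤ.+ ∑ elements inverseSumCount) ℤ.- (∑ elements inverseSumCount ℤ.+ 1ℤ) ℤ.+ 1ℤ
      ≡⟨ cong₂ (λ u v → u ℤ.- v ℤ.+ 1ℤ) ∑[normOne+inverseSum]≡q+q ∑-inverseSumCount ⟩
    (q ℤ.+ q) ℤ.- q ℤ.+ 1ℤ
      ≡⟨ solve 1 (λ q → (q :+ q) :- q :+ con 1ℤ := q :+ con 1ℤ) refl q ⟩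
    q ℤ.+ 1ℤ ∎
    where
    open ≡-Reasoning
    open +-*-Solver using (solve; _:=_; _:+_; _:-_; con)
    ∑[normOne+inverseSum]≡q+q : ∑ elements normOneCount ℤ.+ ∑ elements inverseSumCount ≡ q ℤ.+ q
    ∑[normOne+inverseSum]≡q+q = trans (sym (∑-∙ elements normOneCount inverseSumCount))
      (trans (∑-cong elements normOneCount+inverseSumCount≡2) (∑-∙ elements (λ _ → 1ℤ) (λ _ → 1ℤ)))

module CharacterSums {r : ℕ} (F : FiniteField r) (χ : AdditiveCharacter F) where

  open FiniteField F
  open FieldProperties F
  open IntegerSums
  open Enumeration _≟_ elements unique complete
  open AdditiveCharacter χ

  -- Translation by a fixed a permutes the field, so Σ ψ = ψ(a) · Σ ψ.
  ∑ψ≡0 : Nontrivial F χ → ∑ elements ψ ≡ 0ℤ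
  ∑ψ≡0 (a , ψa≢1) with ∑ elements ψ ℤ.≟ 0ℤ
  ... | yes ∑ψ≡0 = ∑ψ≡0
  ... | no  ∑ψ≢0 = contradiction (sym (ℤP.*-cancelˡ-≡ (∑ elements ψ) 1ℤ (ψ a) {{ℤ.≢-nonZero ∑ψ≢0}}
                                          (trans (ℤP.*-identityʳ _) ∑ψ≡∑ψ*ψa)))
                                 ψa≢1
    where
    ∑ψ≡∑ψ*ψa : ∑ elements ψ ≡ ∑ elements ψ ℤ.* ψ a
    ∑ψ≡∑ψ*ψa = trans (sym (∑-reindex (_+ a) (_+ a) (x+a+a≡x a) (x+a+a≡x a) ψ))
                     (trans (∑-cong elements (λ x → ψ-hom x a)) (∑-*ʳ elements ψ (ψ a)))

module TraceSums {r : ℕ} (F : FiniteField r) (c : FiniteField.Carrier F) (irreducible : IrreducibleZ²+Z+ F c)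
                 (χ : AdditiveCharacter F) where

  open FiniteField F
  open FieldProperties F
  open IntegerSums
  open Enumeration _≟_ elements unique complete
  open OrthogonalGroup F c
  open RootCounts F using (q)
  open NormCounts F c irreducible
  open CharacterSums F χ
  open AdditiveCharacter χ
  open IsCommutativeRing isCommutativeRing using (+-assoc; +-identityˡ)

  ∑-allMat₂ : (g : Mat₂ F → ℤ) →
    ∑ (allMat₂ F) g ≡ ∑ elements (λ a → ∑ elements (λ b → ∑ elements (λ e → ∑ elements (λ f → g (a , b , e , f)))))
  ∑-allMat₂ g = trans (∑-cartesianProduct elements _ g) (∑-cong elements (λ a →
                  trans (∑-cartesianProduct elements _ _) (∑-cong elements (λ b → ∑-cartesianProduct elements elements _))))

  ∑-Parametrised : ∀ b f (g : Mat₂ F → ℤ) →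
    ∑ (allMat₂ F) (λ M → when (Parametrised? b f M) (g M)) ≡
    ∑ elements (λ a → ∑ elements (λ e → when (θ F c (a , e) ≟ 1#) (g (a , b a e , e , f a e))))
  ∑-Parametrised b f g = trans (∑-allMat₂ _) (∑-cong elements (λ a → begin
      ∑ elements (λ m₁₂ → ∑ elements (λ e → ∑ elements (λ m₂₂ → when (Parametrised? b f (a , m₁₂ , e , m₂₂)) (g (a , m₁₂ , e , m₂₂)))))
        ≡⟨ ∑-cong elements (λ m₁₂ → ∑-cong elements (λ e → ∑-cong elements (λ m₂₂ →
             trans (when-× (m₁₂ ≟ b a e) _ _) (cong (when (m₁₂ ≟ b a e)) (when-× (m₂₂ ≟ f a e) _ _))))) ⟩
      ∑ elements (λ m₁₂ → ∑ elements (λ e → ∑ elements (λ m₂₂ →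
        when (m₁₂ ≟ b a e) (when (m₂₂ ≟ f a e) (G a e m₁₂ m₂₂)))))
        ≡⟨ ∑-cong elements (λ m₁₂ → ∑-cong elements (λ e →
             trans (∑-when elements (m₁₂ ≟ b a e) _) (cong (when (m₁₂ ≟ b a e)) (∑-δ (f a e) (G a e m₁₂))))) ⟩
      ∑ elements (λ m₁₂ → ∑ elements (λ e → when (m₁₂ ≟ b a e) (G a e m₁₂ (f a e))))
        ≡⟨ ∑-comm elements elements _ ⟩
      ∑ elements (λ e → ∑ elements (λ m₁₂ → when (m₁₂ ≟ b a e) (G a e m₁₂ (f a e))))
        ≡⟨ ∑-cong elements (λ e → ∑-δ (b a e) (λ m₁₂ → G a e m₁₂ (f a e))) ⟩
      ∑ elements (λ e → G a e (b a e) (f a e)) ∎))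
    where
    open ≡-Reasoning
    G : Carrier → Carrier → Carrier → Carrier → ℤ
    G a e m₁₂ m₂₂ = when (θ F c (a , e) ≟ 1#) (g (a , m₁₂ , e , m₂₂))

  charSum-SO⁻ : charSumTr F χ (SO⁻ F c) ≡ ∑ elements (λ e → normOneCount e ℤ.* ψ e)
  charSum-SO⁻ = begin
    charSumTr F χ (SO⁻ F c)
      ≡⟨ ∑-filter (InSO⁻? F c) (allMat₂ F) (λ M → ψ (tr F M)) ⟩
    ∑ (allMat₂ F) (λ M → when (InSO⁻? F c M) (ψ (tr F M)))
      ≡⟨ ∑-Parametrised (λ a e → c * e) (λ a e → a + e) (λ M → ψ (tr F M)) ⟩
    ∑ elements (λ a → ∑ elements (λ e → when (θ F c (a , e) ≟ 1#) (ψ (a + (a + e)))))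
      ≡⟨ ∑-cong elements (λ a → ∑-cong elements (λ e → cong (when (θ F c (a , e) ≟ 1#)) (cong ψ (a+[a+e]≡e a e)))) ⟩
    ∑ elements (λ a → ∑ elements (λ e → when (θ F c (a , e) ≟ 1#) (ψ e)))
      ≡⟨ ∑-comm elements elements _ ⟩
    ∑ elements (λ e → ∑ elements (λ a → when (θ F c (a , e) ≟ 1#) (ψ e)))
      ≡⟨ ∑-cong elements (λ e → ∑-when≡count* (λ a → θ F c (a , e) ≟ 1#) elements (ψ e)) ⟩
    ∑ elements (λ e → normOneCount e ℤ.* ψ e) ∎
    where
    open ≡-Reasoning
    a+[a+e]≡e : ∀ a e → a + (a + e) ≡ e
    a+[a+e]≡e a e = trans (sym (+-assoc a a e)) (trans (cong (_+ e) (x+x≡0 a)) (+-identityˡ e))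

  K≡∑inverseSumCount*ψ : K F χ 1# ≡ ∑ elements (λ β → inverseSumCount β ℤ.* ψ β)
  K≡∑inverseSumCount*ψ = begin
    K F χ 1#
      ≡⟨ ∑-filter (λ α → ¬? (α ≟ 0#)) elements (λ α → ψ (α + 1# * α ⁻¹)) ⟩
    ∑ elements (λ α → when (¬? (α ≟ 0#)) (ψ (α + 1# * α ⁻¹)))
      ≡⟨ ∑-cong elements (λ α → cong (when (¬? (α ≟ 0#))) (sym (∑-δ (α + 1# * α ⁻¹) ψ))) ⟩
    ∑ elements (λ α → when (¬? (α ≟ 0#)) (∑ elements (λ β → when (β ≟ α + 1# * α ⁻¹) (ψ β))))
      ≡⟨ ∑-cong elements (λ α → sym (∑-when elements (¬? (α ≟ 0#)) _)) ⟩
    ∑ elements (λ α → ∑ elements (λ β → when (¬? (α ≟ 0#)) (when (β ≟ α + 1# * α ⁻¹) (ψ β))))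
      ≡⟨ ∑-comm elements elements _ ⟩
    ∑ elements (λ β → ∑ elements (λ α → when (¬? (α ≟ 0#)) (when (β ≟ α + 1# * α ⁻¹) (ψ β))))
      ≡⟨ ∑-cong elements (λ β → trans (∑-cong elements (λ α → when-when≡when-when1* (¬? (α ≟ 0#)) (β ≟ α + 1# * α ⁻¹) (ψ β)))
                                      (∑-*ʳ elements _ (ψ β))) ⟩
    ∑ elements (λ β → inverseSumCount β ℤ.* ψ β) ∎
    where
    open ≡-Reasoning
    when-when≡when-when1* : {P Q : Set} (p : Dec P) (q : Dec Q) (v : ℤ) → when p (when q v) ≡ when p (when q 1ℤ) ℤ.* v
    when-when≡when-when1* p q v = trans (sym (when-× p q v)) (trans (when≡when1* (p ×-dec q) v) (cong (ℤ._* v) (when-× p q 1ℤ)))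

  charSum-SO⁻≡-K : Nontrivial F χ → charSumTr F χ (SO⁻ F c) ≡ ℤ.- K F χ 1#
  charSum-SO⁻≡-K nontrivial = begin
    charSumTr F χ (SO⁻ F c)
      ≡⟨ solve 2 (λ s k → s := (s :+ k) :- k) refl (charSumTr F χ (SO⁻ F c)) (K F χ 1#) ⟩
    (charSumTr F χ (SO⁻ F c) ℤ.+ K F χ 1#) ℤ.- K F χ 1#
      ≡⟨ cong (ℤ._- K F χ 1#) charSum-SO⁻+K≡0 ⟩
    0ℤ ℤ.- K F χ 1#
      ≡⟨ ℤP.+-identityˡ _ ⟩
    ℤ.- K F χ 1# ∎
    where
    open ≡-Reasoning
    open +-*-Solver using (solve; _:=_; _:+_; _:-_)
    charSum-SO⁻+K≡0 : charSumTr F χ (SO⁻ F c) ℤ.+ K F χ 1# ≡ 0ℤ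
    charSum-SO⁻+K≡0 = begin
      charSumTr F χ (SO⁻ F c) ℤ.+ K F χ 1#
        ≡⟨ cong₂ ℤ._+_ charSum-SO⁻ K≡∑inverseSumCount*ψ ⟩
      ∑ elements (λ e → normOneCount e ℤ.* ψ e) ℤ.+ ∑ elements (λ e → inverseSumCount e ℤ.* ψ e)
        ≡⟨ sym (∑-∙ elements _ _) ⟩
      ∑ elements (λ e → normOneCount e ℤ.* ψ e ℤ.+ inverseSumCount e ℤ.* ψ e)
        ≡⟨ ∑-cong elements (λ e → trans (sym (ℤP.*-distribʳ-+ (ψ e) (normOneCount e) (inverseSumCount e)))
                                        (trans (cong (ℤ._* ψ e) (normOneCount+inverseSumCount≡2 e))
                                               (solve 1 (λ x → con (ℤ.+ 2) :* x := x :+ x) refl (ψ e)))) ⟩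
      ∑ elements (λ e → ψ e ℤ.+ ψ e)
        ≡⟨ ∑-∙ elements ψ ψ ⟩
      ∑ elements ψ ℤ.+ ∑ elements ψ
        ≡⟨ cong₂ ℤ._+_ (∑ψ≡0 nontrivial) (∑ψ≡0 nontrivial) ⟩
      0ℤ ∎
      where open +-*-Solver using (_:*_; con)

  charSum-reflections : ∑ (allMat₂ F) (λ M → when (InReflection? M) (ψ (tr F M))) ≡ q ℤ.+ 1ℤ
  charSum-reflections = begin
    ∑ (allMat₂ F) (λ M → when (InReflection? M) (ψ (tr F M)))
      ≡⟨ ∑-Parametrised (λ a e → c * e + a) (λ a e → a) (λ M → ψ (tr F M)) ⟩
    ∑ elements (λ a → ∑ elements (λ e → when (θ F c (a , e) ≟ 1#) (ψ (a + a))))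
      ≡⟨ ∑-cong elements (λ a → ∑-cong elements (λ e → cong (when (θ F c (a , e) ≟ 1#)) (trans (cong ψ (x+x≡0 a)) ψ-0))) ⟩
    ∑ elements (λ a → ∑ elements (λ e → when (θ F c (a , e) ≟ 1#) 1ℤ))
      ≡⟨ ∑-comm elements elements _ ⟩
    ∑ elements normOneCount
      ≡⟨ ∑-normOneCount ⟩
    q ℤ.+ 1ℤ ∎
    where open ≡-Reasoning

  charSum-O⁻ : charSumTr F χ (O⁻ F c) ≡ charSumTr F χ (SO⁻ F c) ℤ.+ (q ℤ.+ 1ℤ)
  charSum-O⁻ = begin
    charSumTr F χ (O⁻ F c)
      ≡⟨ ∑-filter (InO⁻? F c) (allMat₂ F) (λ M → ψ (tr F M)) ⟩
    ∑ (allMat₂ F) (λ M → when (InO⁻? F c M) (ψ (tr F M)))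
      ≡⟨ ∑-cong (allMat₂ F) (λ M → when-⊎ (InO⁻? F c M) (InSO⁻? F c M) (InReflection? M)
            (InO⁻⇒InSO⁻⊎InReflection M) (InSO⁻⇒InO⁻ M) (InReflection⇒InO⁻ M) (InSO⁻⇒¬InReflection M) (ψ (tr F M))) ⟩
    ∑ (allMat₂ F) (λ M → when (InSO⁻? F c M) (ψ (tr F M)) ℤ.+ when (InReflection? M) (ψ (tr F M)))
      ≡⟨ ∑-∙ (allMat₂ F) _ _ ⟩
    ∑ (allMat₂ F) (λ M → when (InSO⁻? F c M) (ψ (tr F M))) ℤ.+ ∑ (allMat₂ F) (λ M → when (InReflection? M) (ψ (tr F M)))
      ≡⟨ cong₂ ℤ._+_ (sym (∑-filter (InSO⁻? F c) (allMat₂ F) (λ M → ψ (tr F M)))) charSum-reflections ⟩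
    charSumTr F χ (SO⁻ F c) ℤ.+ (q ℤ.+ 1ℤ) ∎
    where open ≡-Reasoning

open import Data.Integer using (+_; -_; _+_)

proposition3 : (r : ℕ) (F : FiniteField r) (c : FiniteField.Carrier F) →
    IrreducibleZ²+Z+ F c →
    (χ : AdditiveCharacter F) → Nontrivial F χ →
    (charSumTr F χ (SO⁻ F c) ≡ - K F χ (FiniteField.1# F))
    × (charSumTr F χ (O⁻ F c) ≡ - K F χ (FiniteField.1# F) + + (2 ^ r) + + 1)
proposition3 r F c irreducible χ nontrivial = charSum-SO⁻≡-K nontrivial , (begin
  charSumTr F χ (O⁻ F c)                       ≡⟨ charSum-O⁻ ⟩
  charSumTr F χ (SO⁻ F c) + (q + + 1)          ≡⟨ cong₂ (λ s n → s + (n + + 1)) (charSum-SO⁻≡-K nontrivial) q≡2^r ⟩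
  - K F χ 1# + (+ (2 ^ r) + + 1)               ≡⟨ sym (ℤP.+-assoc (- K F χ 1#) (+ (2 ^ r)) (+ 1)) ⟩
  - K F χ 1# + + (2 ^ r) + + 1                 ∎)
  where
  open FiniteField F using (1#)
  open TraceSums F c irreducible χ
  open RootCounts F using (q; q≡2^r)
  open ≡-Reasoning
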